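{- Let $G$ be a connected bipartite graph with bipartition $V_1,V_2$. If $G$ is $2$-$\gamma_{\rm MB}'$-critical, then either $G$ is isomorphic to $K_{2,m}$ for some $m\ge 3$, or $|V_1|\ge 3$, $|V_2|\ge 3$, each $V_i$, $i\in\{1,2\}$, contains exactly two bipartite dominating vertices, and all other vertices of $G$ have degree $2$.
   Context: In a connected bipartite graph with bipartition $V_1,V_2$, a vertex $x\in V_i$ is a bipartite dominating vertex if $x$ is adjacent to all vertices of the other part $V_{3-i}$. The Maker-Breaker domination (MBD) game on a graph $G$ is played by Dominator and Staller, who alternately select previously unselected vertices of $G$. Dominator wins if the set of vertices he has selected becomes a dominating set of $G$; Staller wins if she has selected at least one vertex of every dominating set of $G$. In the S-game Staller moves first. $\gamma_{\rm MB}'(G)$ is the minimum number $k$ such that Dominator has a strategy in the S-game guaranteeing that he wins having made at most $k$ moves, whatever Staller does; $\gamma_{\rm MB}'(G)=\infty$ if Dominator has no winning strategy in the S-game. A graph $G$ is $k$-$\gamma_{\rm MB}'$-critical if $\gamma_{\rm MB}'(G)=k$ and $\gamma_{\rm MB}'(G)<\gamma_{\rm MB}'(G-e)$ for every $e\in E(G)$. -}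

module Defs where

open import Data.Nat using (ℕ; zero; suc; _≤_; _<_; _<ᵇ_)
open import Data.Bool using (Bool; true; false; _∧_; _∨_; not; if_then_else_; _xor_)
open import Data.Fin using (Fin; toℕ; _≟_)
open import Data.List using (List; length; filterᵇ)
open import Data.Fin.Base using ()
open import Data.List.Base using ()
open import Data.Product using (Σ; ∃; _×_; _,_)
open import Data.Sum using (_⊎_)
open import Relation.Nullary using (¬_; ⌊_⌋)
open import Relation.Binary.PropositionalEquality using (_≡_; _≢_)
open import Function.Bundles using (_↔_; Inverse)
import Data.Bool.Properties as BP
open import Data.List using (allFin) public

record Graph (n : ℕ) : Set where
  field
    adj    : Fin n → Fin n → Bool
    sym    : ∀ u v → adj u v ≡ adj v u
    irrefl : ∀ v → adj v v ≡ false
open Graph public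

Adj : ℕ → Set
Adj n = Fin n → Fin n → Bool

deleteEdge : ∀ {n} → Adj n → Fin n → Fin n → Adj n
deleteEdge a u v x y =
  a x y ∧ not ((⌊ x ≟ u ⌋ ∧ ⌊ y ≟ v ⌋) ∨ (⌊ x ≟ v ⌋ ∧ ⌊ y ≟ u ⌋))

data Reach {n} (a : Adj n) : Fin n → Fin n → Set where
  here : ∀ {u} → Reach a u u
  step : ∀ {u v w} → Reach a u v → a v w ≡ true → Reach a u w

Connected : ∀ {n} → Adj n → Set
Connected a = ∀ u v → Reach a u v

-- bipartition V1 = {v | side v ≡ true}, V2 = {v | side v ≡ false}
IsBipartition : ∀ {n} → Adj n → (Fin n → Bool) → Set
IsBipartition a side = ∀ u v → a u v ≡ true → side u ≢ side v

BipDom : ∀ {n} → Adj n → (Fin n → Bool) → Fin n → Set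
BipDom a side x = ∀ y → side y ≢ side x → a x y ≡ true

partSize : ∀ {n} → (Fin n → Bool) → Bool → ℕ
partSize side b = length (filterᵇ (λ v → ⌊ side v BP.≟ b ⌋) (allFin _))

degree : ∀ {n} → Adj n → Fin n → ℕ
degree a v = length (filterᵇ (a v) (allFin _))

VSet : ℕ → Set
VSet n = Fin n → Bool

emptyV : ∀ {n} → VSet n
emptyV _ = false

addV : ∀ {n} → VSet n → Fin n → VSet n
addV D v x = if ⌊ x ≟ v ⌋ then true else D x

Dominating : ∀ {n} → Adj n → VSet n → Set
Dominating a D = ∀ v → D v ≡ true ⊎ Σ _ (λ u → D u ≡ true × a u v ≡ true)

Free : ∀ {n} → VSet n → VSet n → Fin n → Set
Free D S v = D v ≡ false × S v ≡ false

data Turn : Set where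
  dom sta : Turn

-- Wins a t k D S : from the position where Dominator has selected D,
-- Staller has selected S and player t is to move, Dominator has a
-- strategy to win having made at most k further moves.
data Wins {n} (a : Adj n) : Turn → ℕ → VSet n → VSet n → Set where
  done  : ∀ {t k D S} → Dominating a D → Wins a t k D S
  dmove : ∀ {k D S} v → Free D S v → Wins a sta k (addV D v) S →
          Wins a dom (suc k) D S
  smove : ∀ {k D S} → Σ _ (λ v → Free D S v) →
          (∀ v → Free D S v → Wins a dom k D (addV S v)) →
          Wins a sta k D S

SWin : ∀ {n} → Adj n → ℕ → Set
SWin a k = Wins a sta k emptyV emptyV

GammaMB'≡ : ∀ {n} → Adj n → ℕ → Set
GammaMB'≡ a k = SWin a k × (∀ j → SWin a j → k ≤ j)

-- k-γ'_MB-critical: γ'(G) = k and γ'(G) < γ'(G - e) for every edge e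
-- (γ'(G-e) may be ∞, i.e. no j with SWin (G-e) j).
Critical : ∀ {n} → Adj n → ℕ → Set
Critical a k = GammaMB'≡ a k ×
  (∀ u v → a u v ≡ true → ∀ j → SWin (deleteEdge a u v) j → k < j)

-- complete bipartite graph K_{2,m} on Fin (2 + m): vertices 0,1 form one part
adjK2 : ∀ m → Adj (suc (suc m))
adjK2 m i j = (toℕ i <ᵇ 2) xor (toℕ j <ᵇ 2)

IsoK2 : ∀ {n} → Adj n → ℕ → Set
IsoK2 {n} a m = Σ (Fin n ↔ Fin (suc (suc m))) λ f →
  ∀ u v → a u v ≡ adjK2 m (Inverse.to f u) (Inverse.to f v)

ExactlyTwoBipDom : ∀ {n} → Adj n → (Fin n → Bool) → Bool → Set
ExactlyTwoBipDom a side b = Σ _ λ x → Σ _ λ y →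
  x ≢ y × side x ≡ b × side y ≡ b × BipDom a side x × BipDom a side y ×
  (∀ z → side z ≡ b → BipDom a side z → z ≡ x ⊎ z ≡ y)

-- A two-move win of Dominator in the S-game gives, for each opening s of Staller, an answer d
-- such that every second Staller move can be met by some d₂ with {d, d₂} dominating;
-- conversely, an answer with two distinct such completions (a double threat) for every opening
-- is a two-move win.  Criticality provides such a win on G, but none on any G − e and no
-- one-move win on G.
--
-- No vertex c dominates G: after Staller opens with c, all of Dominator's vertices lie in the
-- part opposite c, so any further vertex of that part stays undominated, and without one
-- G = K₂ has γ' = 1.  Hence both parts have at least two vertices.  Two parts of size two are
-- impossible: G is then a path or cycle on four vertices, and deleting a suitable edge leaves a
-- perfect matching, on which Dominator still wins in two moves by pairing.  If one part is
-- {a₁, a₂} and the other has at least three vertices, every vertex y of the other part is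
-- adjacent to both aᵢ: otherwise Staller opens with y's only neighbour, forcing Dominator to
-- take y, then takes the other aᵢ, and Dominator's second vertex lies in y's part and misses a
-- third vertex there.  So G ≅ K₂,ₘ.
--
-- If both parts have at least three vertices, every dominating pair meets both parts, which
-- makes the answer and both completions of a double threat bipartite dominating; this yields
-- two bipartite dominating vertices in each part.  These four alone give Dominator a two-move
-- win, so no edge avoiding them can be deleted.  That rules out a third bipartite dominating
-- vertex, and any neighbour of another vertex besides the two bipartite dominating vertices
-- of the opposite part.

{-# OPTIONS --safe #-}
module Submission where

open import Defs hiding (sym)
open import Data.Nat using (ℕ; zero; suc; _≤_; s≤s; z≤n; _+_; _∸_; _<ᵇ_)
open import Data.Nat.Properties using (<-irrefl; +-suc; ∸-monoˡ-≤)
open import Data.Bool using (Bool; true; false; not; _∧_; _∨_; _xor_; T)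
open import Data.Bool.Properties
  using (¬-not; not-¬; ∧-comm; ∨-comm; ∧-identityʳ; ∧-zeroʳ; T-≡)
  renaming (_≟_ to _≟ᵇ_)
open import Data.Fin using (Fin; zero; suc; toℕ; _≟_; punchOut; punchIn)
open import Data.Fin.Properties using (any?; punchIn-punchOut)
open import Data.Fin.Permutation
  using (Permutation′; _⟨$⟩ʳ_; insert; insert-punchIn)
import Data.Fin.Permutation as Permutation
open import Data.List using (List; []; _∷_; length; filterᵇ; allFin)
open import Data.List.Properties using (length-tabulate)
open import Data.List.Membership.Propositional using (_∈_)
open import Data.List.Membership.Propositional.Properties using (∈-filter⁺; ∈-filter⁻; ∈-allFin)
open import Data.List.Relation.Unary.Any using (here; there)
open import Data.List.Relation.Unary.AllPairs using (_∷_)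
open import Data.List.Relation.Unary.All using (_∷_)
open import Data.List.Relation.Unary.Unique.Propositional using (Unique)
import Data.List.Relation.Unary.Unique.Propositional.Properties as Unique
open import Data.Product using (Σ; _×_; _,_; proj₁; proj₂)
open import Data.Sum using (_⊎_; inj₁; inj₂; swap; reduce)
import Data.Sum as Sum
open import Data.Empty using (⊥; ⊥-elim)
open import Function using (_∘_; id; Equivalence; Injection)
open import Function.Properties.Inverse using (↔⇒↣)
open import Relation.Nullary using (¬_; yes; no; ⌊_⌋; contradiction)
open import Relation.Nullary.Decidable using (T?; toWitness; fromWitness; ¬?; _×-dec_)
open import Relation.Binary.PropositionalEquality
  using (_≡_; _≢_; refl; sym; trans; cong; cong₂; subst; ≢-sym; module ≡-Reasoning)

private
  variable
    n : ℕ
    A : Set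

both-≢⇒≡ : ∀ {x y b : Bool} → x ≢ b → y ≢ b → x ≡ y
both-≢⇒≡ x≢b y≢b = trans (¬-not x≢b) (sym (¬-not y≢b))

≡-not⇒≢ : ∀ {x y c : Bool} → x ≡ c → y ≡ not c → x ≢ y
≡-not⇒≢ x≡c y≡¬c x≡y = not-¬ x≡c (trans x≡y y≡¬c)

no-three-in-pair : ∀ {x y z u v : A} → x ≢ y → x ≢ z → y ≢ z →
  x ≡ u ⊎ x ≡ v → y ≡ u ⊎ y ≡ v → z ≡ u ⊎ z ≡ v → ⊥
no-three-in-pair x≢y _ _ (inj₁ refl) (inj₁ refl) _ = x≢y refl
no-three-in-pair x≢y _ _ (inj₂ refl) (inj₂ refl) _ = x≢y refl
no-three-in-pair _ x≢z _ (inj₁ refl) _ (inj₁ refl) = x≢z refl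
no-three-in-pair _ x≢z _ (inj₂ refl) _ (inj₂ refl) = x≢z refl
no-three-in-pair _ _ y≢z _ (inj₁ refl) (inj₁ refl) = y≢z refl
no-three-in-pair _ _ y≢z _ (inj₂ refl) (inj₂ refl) = y≢z refl

-- Counting

record ExactlyTwo (P : A → Set) : Set where
  constructor exactlyTwo
  field
    x₁ x₂ : A
    x₁≢x₂ : x₁ ≢ x₂
    P-x₁  : P x₁
    P-x₂  : P x₂
    only  : ∀ {x} → P x → x ≡ x₁ ⊎ x ≡ x₂

exactlyTwo-swap : {P : A → Set} → ExactlyTwo P → ExactlyTwo P
exactlyTwo-swap (exactlyTwo x₁ x₂ x₁≢x₂ P-x₁ P-x₂ only) =
  exactlyTwo x₂ x₁ (≢-sym x₁≢x₂) P-x₂ P-x₁ (swap ∘ only)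

record Three (P : A → Set) : Set where
  constructor three
  field
    x y z : A
    x≢y   : x ≢ y
    x≢z   : x ≢ z
    y≢z   : y ≢ z
    P-x   : P x
    P-y   : P y
    P-z   : P z

avoid₂ : {P : Fin n → Set} → Three P → (u v : Fin n) → Σ (Fin n) λ w → P w × w ≢ u × w ≢ v
avoid₂ (three x y z x≢y x≢z y≢z P-x P-y P-z) u v with x ≟ u | x ≟ v
... | no x≢u   | no x≢v = x , P-x , x≢u , x≢v
... | yes refl | _ with y ≟ v
...   | no y≢v   = y , P-y , ≢-sym x≢y , y≢v
...   | yes refl = z , P-z , ≢-sym x≢z , ≢-sym y≢z
avoid₂ (three x y z x≢y x≢z y≢z P-x P-y P-z) u v | no x≢u | yes refl with y ≟ u
...   | no y≢u   = y , P-y , y≢u , ≢-sym x≢y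
...   | yes refl = z , P-z , ≢-sym y≢z , ≢-sym x≢z

data Census (P : A → Set) (size : ℕ) : Set where
  none : (∀ x → ¬ P x) → Census P size
  one  : ∀ {x} → P x → (∀ {y} → P y → y ≡ x) → Census P size
  two  : ExactlyTwo P → size ≡ 2 → Census P size
  many : Three P → 3 ≤ size → Census P size

census-map : ∀ {P Q : A → Set} {size} → (∀ {x} → P x → Q x) → (∀ {x} → Q x → P x) →
  Census P size → Census Q size
census-map to from (none ¬P) = none (λ x → ¬P x ∘ from)
census-map to from (one P-x only) = one (to P-x) (only ∘ from)
census-map to from (two (exactlyTwo x₁ x₂ x₁≢x₂ P-x₁ P-x₂ only) size≡2) =
  two (exactlyTwo x₁ x₂ x₁≢x₂ (to P-x₁) (to P-x₂) (only ∘ from)) size≡2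
census-map to from (many (three x y z x≢y x≢z y≢z P-x P-y P-z) 3≤size) =
  many (three x y z x≢y x≢z y≢z (to P-x) (to P-y) (to P-z)) 3≤size

census-of-list : {P : A → Set} (xs : List A) → Unique xs →
  (∀ {x} → P x → x ∈ xs) → (∀ {x} → x ∈ xs → P x) → Census P (length xs)
census-of-list [] _ complete _ = none λ x P-x → contradiction (complete P-x) λ ()
census-of-list (x ∷ []) _ complete sound = one (sound (here refl)) (singleton ∘ complete)
  where
  singleton : ∀ {y} → y ∈ x ∷ [] → y ≡ x
  singleton (here y≡x) = y≡x
census-of-list (x ∷ y ∷ []) ((x≢y ∷ _) ∷ _) complete sound =
  two (exactlyTwo x y x≢y (sound (here refl)) (sound (there (here refl))) (pair ∘ complete)) refl
  where
  pair : ∀ {v} → v ∈ x ∷ y ∷ [] → v ≡ x ⊎ v ≡ y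
  pair (here v≡x)         = inj₁ v≡x
  pair (there (here v≡y)) = inj₂ v≡y
census-of-list (x ∷ y ∷ z ∷ _) ((x≢y ∷ x≢z ∷ _) ∷ (y≢z ∷ _) ∷ _) _ sound =
  many (three x y z x≢y x≢z y≢z (sound (here refl)) (sound (there (here refl)))
                                (sound (there (there (here refl)))))
       (s≤s (s≤s (s≤s z≤n)))

census : (p : Fin n → Bool) → Census (T ∘ p) (length (filterᵇ p (allFin n)))
census p = census-of-list _ (Unique.filter⁺ (T? ∘ p) (Unique.allFin⁺ _))
  (∈-filter⁺ (T? ∘ p) (∈-allFin _)) (proj₂ ∘ ∈-filter⁻ (T? ∘ p) {xs = allFin _})

partCensus : (side : Fin n → Bool) (b : Bool) → Census (λ v → side v ≡ b) (partSize side b)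
partCensus side b = census-map toWitness fromWitness (census _)

adjacencyCensus : (a : Adj n) (v : Fin n) → Census (λ w → a v w ≡ true) (degree a v)
adjacencyCensus a v = census-map (Equivalence.to T-≡) (Equivalence.from T-≡) (census (a v))

exactlyTwo⇒size≡2 : ∀ {P : A → Set} {size} → ExactlyTwo P → Census P size → size ≡ 2
exactlyTwo⇒size≡2 (exactlyTwo _ _ _ P-x₁ _ _)     (none ¬P)       = ⊥-elim (¬P _ P-x₁)
exactlyTwo⇒size≡2 (exactlyTwo _ _ x₁≢x₂ P-x₁ P-x₂ _) (one _ only)  =
  ⊥-elim (x₁≢x₂ (trans (only P-x₁) (sym (only P-x₂))))
exactlyTwo⇒size≡2 _ (two _ size≡2) = size≡2
exactlyTwo⇒size≡2 (exactlyTwo _ _ _ _ _ only) (many (three _ _ _ x≢y x≢z y≢z P-x P-y P-z) _) =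
  ⊥-elim (no-three-in-pair x≢y x≢z y≢z (only P-x) (only P-y) (only P-z))

length-filterᵇ-complement : (p q : A → Bool) → (∀ x → q x ≡ not (p x)) → (xs : List A) →
  length (filterᵇ p xs) + length (filterᵇ q xs) ≡ length xs
length-filterᵇ-complement p q q≡¬p [] = refl
length-filterᵇ-complement p q q≡¬p (x ∷ xs) with p x | q x | q≡¬p x
... | true  | false | _ = cong suc (length-filterᵇ-complement p q q≡¬p xs)
... | false | true  | _ =
  trans (+-suc _ _) (cong suc (length-filterᵇ-complement p q q≡¬p xs))

partSize-sum : (side : Fin n → Bool) (b : Bool) → partSize side b + partSize side (not b) ≡ n
partSize-sum {n} side b =
  trans (length-filterᵇ-complement _ _ (λ v → complement (side v) b) (allFin n)) (length-tabulate _)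
  where
  complement : ∀ x b → ⌊ x ≟ᵇ not b ⌋ ≡ not ⌊ x ≟ᵇ b ⌋
  complement false false = refl
  complement false true  = refl
  complement true  false = refl
  complement true  true  = refl

-- Domination by one or two vertices

⁅_⁆ : Fin n → VSet n
⁅ v ⁆ = addV emptyV v

addV-self : (D : VSet n) (v : Fin n) → addV D v v ≡ true
addV-self D v with v ≟ v
... | yes _   = refl
... | no v≢v = contradiction refl v≢v

addV-keep : (D : VSet n) {v x : Fin n} → D x ≡ true → addV D v x ≡ true
addV-keep D {v} {x} x∈D with x ≟ v
... | yes _ = refl
... | no _  = x∈D

addV-other : (D : VSet n) {v x : Fin n} → x ≢ v → addV D v x ≡ D x
addV-other D {v} {x} x≢v with x ≟ v
... | yes x≡v = contradiction x≡v x≢v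
... | no _    = refl

addV-∈ : (D : VSet n) {v x : Fin n} → addV D v x ≡ true → x ≡ v ⊎ D x ≡ true
addV-∈ D {v} {x} x∈ with x ≟ v
... | yes x≡v = inj₁ x≡v
... | no _    = inj₂ x∈

addV-∉ : (D : VSet n) {v x : Fin n} → addV D v x ≡ false → x ≢ v × D x ≡ false
addV-∉ D {v} {x} x∉ with x ≟ v
addV-∉ D {v} {x} () | yes _
... | no x≢v = x≢v , x∉

pair-∉ : ∀ {u v x : Fin n} → x ≢ u → x ≢ v → addV ⁅ u ⁆ v x ≡ false
pair-∉ {u = u} x≢u x≢v = trans (addV-other ⁅ u ⁆ x≢v) (addV-other emptyV x≢u)

Covers : Adj n → Fin n → Fin n → Set
Covers a x z = z ≡ x ⊎ a x z ≡ true

Dominates₁ : Adj n → Fin n → Set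
Dominates₁ a x = ∀ z → Covers a x z

Dominates₂ : Adj n → Fin n → Fin n → Set
Dominates₂ a x y = ∀ z → Covers a x z ⊎ Covers a y z

DominatedBy : Adj n → VSet n → Fin n → Set
DominatedBy a D z = D z ≡ true ⊎ Σ _ λ u → D u ≡ true × a u z ≡ true

module _ {a : Adj n} where

  dominatedBy-emptyV : ∀ {z} → ¬ DominatedBy a emptyV z
  dominatedBy-emptyV (inj₁ ())
  dominatedBy-emptyV (inj₂ (_ , () , _))

  dominatedBy-addV⁻ : ∀ {D v z} → DominatedBy a (addV D v) z → DominatedBy a D z ⊎ Covers a v z
  dominatedBy-addV⁻ {D} (inj₁ z∈) = Sum.map inj₁ inj₁ (swap (addV-∈ D z∈))
  dominatedBy-addV⁻ {D} (inj₂ (u , u∈ , auz)) with addV-∈ D u∈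
  ... | inj₁ refl = inj₂ (inj₂ auz)
  ... | inj₂ u∈D  = inj₁ (inj₂ (u , u∈D , auz))

  dominatedBy-addV⁺ : ∀ {D v z} → DominatedBy a D z ⊎ Covers a v z → DominatedBy a (addV D v) z
  dominatedBy-addV⁺ {D} (inj₁ (inj₁ z∈D))             = inj₁ (addV-keep D z∈D)
  dominatedBy-addV⁺ {D} (inj₁ (inj₂ (u , u∈D , auz))) = inj₂ (u , addV-keep D u∈D , auz)
  dominatedBy-addV⁺ {D} (inj₂ (inj₁ refl))            = inj₁ (addV-self D _)
  dominatedBy-addV⁺ {D} (inj₂ (inj₂ avz))             = inj₂ (_ , addV-self D _ , avz)

  dominatedBy-⁅⁆⁻ : ∀ {v z} → DominatedBy a ⁅ v ⁆ z → Covers a v z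
  dominatedBy-⁅⁆⁻ = Sum.[ ⊥-elim ∘ dominatedBy-emptyV , id ] ∘ dominatedBy-addV⁻

  dominatedBy-⁅⁆⁺ : ∀ {v z} → Covers a v z → DominatedBy a ⁅ v ⁆ z
  dominatedBy-⁅⁆⁺ = dominatedBy-addV⁺ ∘ inj₂

  dominating-⁅⁆⁻ : ∀ {x} → Dominating a ⁅ x ⁆ → Dominates₁ a x
  dominating-⁅⁆⁻ D = dominatedBy-⁅⁆⁻ ∘ D

  dominating-⁅⁆⁺ : ∀ {x} → Dominates₁ a x → Dominating a ⁅ x ⁆
  dominating-⁅⁆⁺ D = dominatedBy-⁅⁆⁺ ∘ D

  dominating-pair⁻ : ∀ {x y} → Dominating a (addV ⁅ x ⁆ y) → Dominates₂ a x y
  dominating-pair⁻ D = Sum.map₁ dominatedBy-⁅⁆⁻ ∘ dominatedBy-addV⁻ ∘ D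

  dominating-pair⁺ : ∀ {x y} → Dominates₂ a x y → Dominating a (addV ⁅ x ⁆ y)
  dominating-pair⁺ D = dominatedBy-addV⁺ ∘ Sum.map₁ dominatedBy-⁅⁆⁺ ∘ D

  dominates₂-comm : ∀ {x y} → Dominates₂ a x y → Dominates₂ a y x
  dominates₂-comm D = swap ∘ D

  dominating-pair-distinct : (∀ c → ¬ Dominates₁ a c) → ∀ {x y} → Dominates₂ a x y → y ≢ x
  dominating-pair-distinct ¬dom {x} D refl = ¬dom x (reduce ∘ D)

-- Short games

inhabitant : {a : Adj n} → ¬ Dominating a emptyV → Fin n
inhabitant {n = zero}  ¬D = ⊥-elim (¬D λ ())
inhabitant {n = suc _} _  = zero

module _ {a : Adj n} where

  out-of-moves : ∀ {D S} → Wins a sta 0 D S → Dominating a D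
  out-of-moves (done D) = D
  out-of-moves (smove (v , free) win) with win v free
  ... | done D = D

  last-move : ∀ {D S} → Wins a dom 1 D S →
    Dominating a D ⊎ Σ _ λ v → S v ≡ false × Dominating a (addV D v)
  last-move (done D)               = inj₁ D
  last-move (dmove v (_ , v∉S) win) = inj₂ (v , v∉S , out-of-moves win)

  -- Dominator's answer d to Staller's opening s in a win within two moves.  The completion d₂
  -- may be d itself, which covers the case that {d} alone already dominates.
  record Reply (s : Fin n) : Set where
    constructor reply
    field
      d      : Fin n
      d≢s    : d ≢ s
      finish : ∀ s₂ → s₂ ≢ s → s₂ ≢ d → Σ _ λ d₂ → d₂ ≢ s × d₂ ≢ s₂ × Dominates₂ a d d₂

  SWin₂⇒reply : ¬ Dominating a emptyV → SWin a 2 → ∀ s → Reply s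
  SWin₂⇒reply ¬D (done D) s = contradiction D ¬D
  SWin₂⇒reply ¬D (smove _ win) s with win s (refl , refl)
  ... | done D = contradiction D ¬D
  ... | dmove d (_ , d∉S) win₁ = reply d d≢s finish
    where
    d≢s : d ≢ s
    d≢s = proj₁ (addV-∉ emptyV d∉S)

    completion-d : ∀ {s₂} → s₂ ≢ d → Dominating a ⁅ d ⁆ →
      Σ _ λ d₂ → d₂ ≢ s × d₂ ≢ s₂ × Dominates₂ a d d₂
    completion-d s₂≢d D = d , d≢s , ≢-sym s₂≢d , inj₁ ∘ dominating-⁅⁆⁻ D

    finish : ∀ s₂ → s₂ ≢ s → s₂ ≢ d → Σ _ λ d₂ → d₂ ≢ s × d₂ ≢ s₂ × Dominates₂ a d d₂
    finish s₂ s₂≢s s₂≢d = second-round win₁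
      where
      second-round : Wins a sta 1 ⁅ d ⁆ ⁅ s ⁆ → Σ _ λ d₂ → d₂ ≢ s × d₂ ≢ s₂ × Dominates₂ a d d₂
      second-round (done D) = completion-d s₂≢d D
      second-round (smove _ win)
        with last-move (win s₂ (addV-other emptyV s₂≢d , addV-other emptyV s₂≢s))
      ... | inj₁ D = completion-d s₂≢d D
      ... | inj₂ (d₂ , d₂∉S , D) with addV-∉ ⁅ s ⁆ d₂∉S
      ...   | d₂≢s₂ , d₂∉⁅s⁆ = d₂ , proj₁ (addV-∉ emptyV d₂∉⁅s⁆) , d₂≢s₂ , dominating-pair⁻ D

  reply-to-sole-neighbour : ∀ {c y} (R : Reply c) → y ≢ c → (∀ {u} → a u y ≡ true → u ≡ c) →
    Reply.d R ≡ y
  reply-to-sole-neighbour {c} {y} (reply d d≢c finish) y≢c sole with d ≟ y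
  ... | yes d≡y = d≡y
  ... | no d≢y with finish y y≢c (≢-sym d≢y)
  ...   | d₂ , d₂≢c , d₂≢y , D with D y
  ...     | inj₁ (inj₁ y≡d)  = contradiction (sym y≡d) d≢y
  ...     | inj₁ (inj₂ ady)  = contradiction (sole ady) d≢c
  ...     | inj₂ (inj₁ y≡d₂) = contradiction (sym y≡d₂) d₂≢y
  ...     | inj₂ (inj₂ ad₂y) = contradiction (sole ad₂y) d₂≢c

  record DoubleThreat (s : Fin n) : Set where
    constructor doubleThreat
    field
      d p q       : Fin n
      d≢s         : d ≢ s
      p≢s         : p ≢ s
      p≢d         : p ≢ d
      q≢s         : q ≢ s
      q≢d         : q ≢ d
      p≢q         : p ≢ q
      dominates-p : Dominates₂ a d p
      dominates-q : Dominates₂ a d q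

  reply⇒doubleThreat : (∀ c → ¬ Dominates₁ a c) → ∀ {s s₂} (R : Reply s) →
    s₂ ≢ s → s₂ ≢ Reply.d R → DoubleThreat s
  reply⇒doubleThreat ¬dom {s} {s₂} (reply d d≢s finish) s₂≢s s₂≢d
    with finish s₂ s₂≢s s₂≢d
  ... | p , p≢s , _ , Dp with finish p p≢s (dominating-pair-distinct ¬dom Dp)
  ...   | q , q≢s , q≢p , Dq = doubleThreat d p q d≢s p≢s (dominating-pair-distinct ¬dom Dp)
                                 q≢s (dominating-pair-distinct ¬dom Dq) (≢-sym q≢p) Dp Dq

  -- The vertex argument only witnesses that Staller has a first move.
  doubleThreat⇒SWin₂ : Fin n → (∀ s → DoubleThreat s) → SWin a 2
  doubleThreat⇒SWin₂ v threat = smove (v , refl , refl) λ s _ → answer (threat s)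
    where
    answer : ∀ {s} → DoubleThreat s → Wins a dom 2 emptyV ⁅ s ⁆
    answer {s} (doubleThreat d p q d≢s p≢s p≢d q≢s q≢d p≢q Dp Dq) =
      dmove d (refl , addV-other emptyV d≢s)
        (smove (p , addV-other emptyV p≢d , addV-other emptyV p≢s) complete)
      where
      complete : ∀ s₂ → Free ⁅ d ⁆ ⁅ s ⁆ s₂ → Wins a dom 1 ⁅ d ⁆ (addV ⁅ s ⁆ s₂)
      complete s₂ _ with s₂ ≟ p
      ... | yes refl =
        dmove q (addV-other emptyV q≢d , pair-∉ q≢s (≢-sym p≢q)) (done (dominating-pair⁺ Dq))
      ... | no s₂≢p  =
        dmove p (addV-other emptyV p≢d , pair-∉ p≢s (≢-sym s₂≢p)) (done (dominating-pair⁺ Dp))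

  two-dominating-vertices⇒SWin₁ : ∀ {x y} → x ≢ y → Dominates₁ a x → Dominates₁ a y → SWin a 1
  two-dominating-vertices⇒SWin₁ {x} {y} x≢y Dx Dy = smove (x , refl , refl) λ s _ → answer s
    where
    answer : ∀ s → Wins a dom 1 emptyV ⁅ s ⁆
    answer s with s ≟ x
    ... | yes refl = dmove y (refl , addV-other emptyV (≢-sym x≢y)) (done (dominating-⁅⁆⁺ Dy))
    ... | no s≢x   = dmove x (refl , addV-other emptyV (≢-sym s≢x)) (done (dominating-⁅⁆⁺ Dx))

  record CrossDominating : Set where
    field
      p₁ p₂ q₁ q₂ : Fin n
      p₁≢p₂     : p₁ ≢ p₂
      q₁≢q₂     : q₁ ≢ q₂
      p≢q       : ∀ {p q} → p ≡ p₁ ⊎ p ≡ p₂ → q ≡ q₁ ⊎ q ≡ q₂ → p ≢ q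
      dominates : ∀ {p q} → p ≡ p₁ ⊎ p ≡ p₂ → q ≡ q₁ ⊎ q ≡ q₂ → Dominates₂ a p q

  crossDominating-flip : CrossDominating → CrossDominating
  crossDominating-flip C = record
    { p₁ = q₁ ; p₂ = q₂ ; q₁ = p₁ ; q₂ = p₂ ; p₁≢p₂ = q₁≢q₂ ; q₁≢q₂ = p₁≢p₂
    ; p≢q = λ q∈ p∈ → ≢-sym (p≢q p∈ q∈)
    ; dominates = λ q∈ p∈ → dominates₂-comm (dominates p∈ q∈)
    }
    where open CrossDominating C

  module _ (C : CrossDominating) where
    open CrossDominating C

    threat-from : ∀ {p s} → p ≡ p₁ ⊎ p ≡ p₂ → p ≢ s → s ≢ q₁ → s ≢ q₂ → DoubleThreat s
    threat-from p∈ p≢s s≢q₁ s≢q₂ =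
      doubleThreat _ q₁ q₂ p≢s (≢-sym s≢q₁) (≢-sym (p≢q p∈ (inj₁ refl))) (≢-sym s≢q₂)
        (≢-sym (p≢q p∈ (inj₂ refl))) q₁≢q₂ (dominates p∈ (inj₁ refl)) (dominates p∈ (inj₂ refl))

    threat-avoiding-q : ∀ {s} → s ≢ q₁ → s ≢ q₂ → DoubleThreat s
    threat-avoiding-q {s} s≢q₁ s≢q₂ with s ≟ p₁
    ... | yes refl = threat-from (inj₂ refl) (≢-sym p₁≢p₂) s≢q₁ s≢q₂
    ... | no s≢p₁  = threat-from (inj₁ refl) (≢-sym s≢p₁) s≢q₁ s≢q₂

  crossDominating⇒SWin₂ : CrossDominating → SWin a 2
  crossDominating⇒SWin₂ C = doubleThreat⇒SWin₂ p₁ threat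
    where
    open CrossDominating C
    threat : ∀ s → DoubleThreat s
    threat s with s ≟ q₁ | s ≟ q₂
    ... | no s≢q₁  | no s≢q₂ = threat-avoiding-q C s≢q₁ s≢q₂
    ... | yes refl | _ = threat-avoiding-q (crossDominating-flip C)
                           (≢-sym (p≢q (inj₁ refl) (inj₁ refl))) (≢-sym (p≢q (inj₂ refl) (inj₁ refl)))
    ... | _ | yes refl = threat-avoiding-q (crossDominating-flip C)
                           (≢-sym (p≢q (inj₁ refl) (inj₂ refl))) (≢-sym (p≢q (inj₂ refl) (inj₂ refl)))

-- Graphs, edge deletion and bipartite domination

module _ {a : Adj n} where

  last-edge : ∀ {u v} → Reach a u v → u ≢ v → Σ _ λ w → a w v ≡ true
  last-edge here            u≢u = contradiction refl u≢u
  last-edge (step {v = w} _ awv) _ = w , awv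

  reach-closed : (P : Fin n → Set) → (∀ {x y} → P x → a x y ≡ true → P y) →
    ∀ {u v} → Reach a u v → P u → P v
  reach-closed P closed here         P-u = P-u
  reach-closed P closed (step r axy) P-u = closed (reach-closed P closed r P-u) axy

not-both : ∀ {x u y v : Fin n} → x ≢ u ⊎ y ≢ v → ⌊ x ≟ u ⌋ ∧ ⌊ y ≟ v ⌋ ≡ false
not-both {x = x} {u} (inj₁ x≢u) with x ≟ u
... | yes x≡u = contradiction x≡u x≢u
... | no _    = refl
not-both {y = y} {v} (inj₂ y≢v) with y ≟ v
... | yes y≡v = contradiction y≡v y≢v
... | no _    = ∧-zeroʳ _

deleteEdge-keeps : (a : Adj n) {u v x y : Fin n} → x ≢ u ⊎ y ≢ v → x ≢ v ⊎ y ≢ u →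
  deleteEdge a u v x y ≡ a x y
deleteEdge-keeps a p q =
  trans (cong (λ t → a _ _ ∧ not t) (cong₂ _∨_ (not-both p) (not-both q))) (∧-identityʳ _)

deleteEdge-sym : (a : Adj n) → (∀ x y → a x y ≡ a y x) →
  ∀ u v x y → deleteEdge a u v x y ≡ deleteEdge a u v y x
deleteEdge-sym a a-sym u v x y = cong₂ _∧_ (a-sym x y) (cong not (begin
  (⌊ x ≟ u ⌋ ∧ ⌊ y ≟ v ⌋) ∨ (⌊ x ≟ v ⌋ ∧ ⌊ y ≟ u ⌋)
    ≡⟨ cong₂ _∨_ (∧-comm ⌊ x ≟ u ⌋ _) (∧-comm ⌊ x ≟ v ⌋ _) ⟩
  (⌊ y ≟ v ⌋ ∧ ⌊ x ≟ u ⌋) ∨ (⌊ y ≟ u ⌋ ∧ ⌊ x ≟ v ⌋)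
    ≡⟨ ∨-comm (⌊ y ≟ v ⌋ ∧ ⌊ x ≟ u ⌋) _ ⟩
  (⌊ y ≟ u ⌋ ∧ ⌊ x ≟ v ⌋) ∨ (⌊ y ≟ v ⌋ ∧ ⌊ x ≟ u ⌋) ∎))
  where open ≡-Reasoning

removeEdge : Graph n → Fin n → Fin n → Graph n
removeEdge G u v = record
  { adj    = deleteEdge (adj G) u v
  ; sym    = deleteEdge-sym (adj G) (Graph.sym G) u v
  ; irrefl = λ x → cong (_∧ _) (irrefl G x)
  }

bipDom-deleteEdge : ∀ {a : Adj n} {side u v x} → BipDom a side x → x ≢ u → x ≢ v →
  BipDom (deleteEdge a u v) side x
bipDom-deleteEdge {a = a} bd x≢u x≢v y sy≢sx =
  trans (deleteEdge-keeps a (inj₁ x≢u) (inj₁ x≢v)) (bd y sy≢sx)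

module _ (G : Graph n) where

  flip-adj : ∀ {u v t} → adj G u v ≡ t → adj G v u ≡ t
  flip-adj {u} {v} = trans (Graph.sym G v u)

  endpoint-covers-edge : ∀ {x y u z} → adj G x y ≡ true → u ≡ x ⊎ u ≡ y → z ≡ x ⊎ z ≡ y →
    Covers (adj G) u z
  endpoint-covers-edge _   (inj₁ refl) (inj₁ z≡x)  = inj₁ z≡x
  endpoint-covers-edge axy (inj₁ refl) (inj₂ refl) = inj₂ axy
  endpoint-covers-edge axy (inj₂ refl) (inj₁ refl) = inj₂ (flip-adj axy)
  endpoint-covers-edge _   (inj₂ refl) (inj₂ z≡y)  = inj₁ z≡y

  matching⇒crossDominating : ∀ {x₁ y₁ x₂ y₂} →
    x₁ ≢ y₁ → x₂ ≢ y₂ → x₁ ≢ x₂ → x₁ ≢ y₂ → y₁ ≢ x₂ → y₁ ≢ y₂ →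
    (∀ v → (v ≡ x₁ ⊎ v ≡ y₁) ⊎ (v ≡ x₂ ⊎ v ≡ y₂)) →
    adj G x₁ y₁ ≡ true → adj G x₂ y₂ ≡ true → CrossDominating {a = adj G}
  matching⇒crossDominating {x₁} {y₁} {x₂} {y₂} x₁≢y₁ x₂≢y₂ x₁≢x₂ x₁≢y₂ y₁≢x₂ y₁≢y₂ cover e₁ e₂ = record
    { p₁ = x₁ ; p₂ = y₁ ; q₁ = x₂ ; q₂ = y₂ ; p₁≢p₂ = x₁≢y₁ ; q₁≢q₂ = x₂≢y₂
    ; p≢q = p≢q
    ; dominates = λ p∈ q∈ z → Sum.map (endpoint-covers-edge e₁ p∈) (endpoint-covers-edge e₂ q∈) (cover z)
    }
    where
    p≢q : ∀ {p q} → p ≡ x₁ ⊎ p ≡ y₁ → q ≡ x₂ ⊎ q ≡ y₂ → p ≢ q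
    p≢q (inj₁ refl) (inj₁ refl) = x₁≢x₂
    p≢q (inj₁ refl) (inj₂ refl) = x₁≢y₂
    p≢q (inj₂ refl) (inj₁ refl) = y₁≢x₂
    p≢q (inj₂ refl) (inj₂ refl) = y₁≢y₂

opposite-sides⇒≢ : (side : Fin n → Bool) {x y : Fin n} {c : Bool} → side x ≡ c → side y ≡ not c → x ≢ y
opposite-sides⇒≢ side sx sy = ≡-not⇒≢ sx sy ∘ cong side

module _ {a : Adj n} {side : Fin n → Bool} where

  bipDom-pair-dominates : ∀ {x y} → side x ≢ side y → BipDom a side x → BipDom a side y →
    Dominates₂ a x y
  bipDom-pair-dominates {x} {y} sx≢sy bx by z with side z ≟ᵇ side x
  ... | no sz≢sx  = inj₁ (inj₂ (bx z sz≢sx))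
  ... | yes sz≡sx = inj₂ (inj₂ (by z (sx≢sy ∘ trans (sym sz≡sx))))

  record BipDomPair (b : Bool) : Set where
    constructor bipDomPair
    field
      u₁ u₂     : Fin n
      u₁≢u₂     : u₁ ≢ u₂
      side-u₁   : side u₁ ≡ b
      side-u₂   : side u₂ ≡ b
      bipDom-u₁ : BipDom a side u₁
      bipDom-u₂ : BipDom a side u₂

    Avoids : Fin n → Set
    Avoids v = v ≢ u₁ × v ≢ u₂

    member-side : ∀ {u} → u ≡ u₁ ⊎ u ≡ u₂ → side u ≡ b
    member-side (inj₁ refl) = side-u₁
    member-side (inj₂ refl) = side-u₂

    member-bipDom : ∀ {u} → u ≡ u₁ ⊎ u ≡ u₂ → BipDom a side u
    member-bipDom (inj₁ refl) = bipDom-u₁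
    member-bipDom (inj₂ refl) = bipDom-u₂

    avoids-by-side : ∀ {v} → side v ≢ b → Avoids v
    avoids-by-side sv≢b = (λ { refl → sv≢b side-u₁ }) , (λ { refl → sv≢b side-u₂ })

    avoids-non-bipDom : ∀ {v} → ¬ BipDom a side v → Avoids v
    avoids-non-bipDom ¬bv = (λ { refl → ¬bv bipDom-u₁ }) , (λ { refl → ¬bv bipDom-u₂ })

    member-or-avoids : ∀ v → (v ≡ u₁ ⊎ v ≡ u₂) ⊎ Avoids v
    member-or-avoids v with v ≟ u₁ | v ≟ u₂
    ... | yes v≡u₁ | _        = inj₁ (inj₁ v≡u₁)
    ... | no _     | yes v≡u₂ = inj₁ (inj₂ v≡u₂)
    ... | no v≢u₁  | no v≢u₂  = inj₂ (v≢u₁ , v≢u₂)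

  bipDomPairs⇒SWin₂ : ∀ {c} → BipDomPair c → BipDomPair (not c) → SWin a 2
  bipDomPairs⇒SWin₂ P Q = crossDominating⇒SWin₂ (record
    { p₁ = P.u₁ ; p₂ = P.u₂ ; q₁ = Q.u₁ ; q₂ = Q.u₂ ; p₁≢p₂ = P.u₁≢u₂ ; q₁≢q₂ = Q.u₁≢u₂
    ; p≢q = λ p∈ q∈ → opposite-sides⇒≢ side (P.member-side p∈) (Q.member-side q∈)
    ; dominates = λ p∈ q∈ → bipDom-pair-dominates (≡-not⇒≢ (P.member-side p∈) (Q.member-side q∈))
                              (P.member-bipDom p∈) (Q.member-bipDom q∈)
    })
    where
    module P = BipDomPair P
    module Q = BipDomPair Q

bipDomPair-deleteEdge : ∀ {a : Adj n} {side b u v} (P : BipDomPair {a = a} {side} b) →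
  BipDomPair.Avoids P u → BipDomPair.Avoids P v → BipDomPair {a = deleteEdge a u v} {side} b
bipDomPair-deleteEdge {a = a} (bipDomPair u₁ u₂ u₁≢u₂ s₁ s₂ b₁ b₂) (u≢u₁ , u≢u₂) (v≢u₁ , v≢u₂) =
  bipDomPair u₁ u₂ u₁≢u₂ s₁ s₂ (bipDom-deleteEdge {a = a} b₁ (≢-sym u≢u₁) (≢-sym v≢u₁))
                               (bipDom-deleteEdge {a = a} b₂ (≢-sym u≢u₂) (≢-sym v≢u₂))

module _ {a : Adj n} {side : Fin n → Bool} (bip : IsBipartition a side) where

  same-side-nonadjacent : ∀ {u v} → side u ≡ side v → a u v ≡ false
  same-side-nonadjacent su≡sv = ¬-not λ auv → bip _ _ auv su≡sv

  neighbour-side : ∀ {u w b} → a u w ≡ true → side u ≡ b → side w ≡ not b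
  neighbour-side auw su≡b = ¬-not λ sw≡b → bip _ _ auw (trans su≡b (sym sw≡b))

  neighbour-side⁻ : ∀ {u w b} → a u w ≡ true → side w ≡ not b → side u ≡ b
  neighbour-side⁻ auw sw≡¬b = both-≢⇒≡ (bip _ _ auw) (λ b≡sw → not-¬ refl (trans b≡sw sw≡¬b))

  dominator-adjacent : ∀ {c v} → Dominates₁ a c → v ≢ c → a c v ≡ true
  dominator-adjacent {v = v} Dc v≢c = Sum.[ (λ v≡c → contradiction v≡c v≢c) , id ] (Dc v)

  dominated-same-side : ∀ {c u v} → Dominates₁ a c → u ≢ c → v ≢ c → side u ≡ side v
  dominated-same-side Dc u≢c v≢c =
    both-≢⇒≡ (≢-sym (bip _ _ (dominator-adjacent Dc u≢c))) (≢-sym (bip _ _ (dominator-adjacent Dc v≢c)))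

  dominating-pair-splits : ∀ {d p w} → Dominates₂ a d p →
    side w ≡ side d → w ≢ d → w ≢ p → side p ≢ side d
  dominating-pair-splits {d} {p} {w} D sw≡sd w≢d w≢p sp≡sd with D w
  ... | inj₁ (inj₁ w≡d) = w≢d w≡d
  ... | inj₁ (inj₂ adw) = bip d w adw (sym sw≡sd)
  ... | inj₂ (inj₁ w≡p) = w≢p w≡p
  ... | inj₂ (inj₂ apw) = bip p w apw (trans sp≡sd (sym sw≡sd))

  across-dominating-pair : ∀ {d p y} → Dominates₂ a d p → side p ≢ side d →
    side y ≢ side d → y ≢ p → a d y ≡ true
  across-dominating-pair {d} {p} {y} D sp≢sd sy≢sd y≢p with D y
  ... | inj₁ (inj₁ y≡d) = contradiction (cong side y≡d) sy≢sd
  ... | inj₁ (inj₂ ady) = ady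
  ... | inj₂ (inj₁ y≡p) = contradiction y≡p y≢p
  ... | inj₂ (inj₂ apy) = contradiction (both-≢⇒≡ sp≢sd sy≢sd) (bip p y apy)

  threats⇒bipDom : ∀ {d p q} → Dominates₂ a d p → Dominates₂ a d q → p ≢ q →
    side p ≢ side d → side q ≢ side d → BipDom a side d
  threats⇒bipDom {p = p} Dp Dq p≢q sp≢sd sq≢sd y sy≢sd with y ≟ p
  ... | no y≢p   = across-dominating-pair Dp sp≢sd sy≢sd y≢p
  ... | yes refl = across-dominating-pair Dq sq≢sd sy≢sd p≢q

partner-bipDom : (G : Graph n) {side : Fin n → Bool} → IsBipartition (adj G) side →
  ∀ {d p} → Dominates₂ (adj G) d p → side p ≢ side d →
  BipDom (adj G) side d → BipDom (adj G) side p
partner-bipDom G bip {d} {p} D sp≢sd bd y sy≢sp with D y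
... | inj₁ (inj₁ refl) = flip-adj G (bd p sp≢sd)
... | inj₁ (inj₂ ady)  = contradiction (both-≢⇒≡ (sp≢sd ∘ sym) sy≢sp) (bip d y ady)
... | inj₂ (inj₁ refl) = contradiction refl sy≢sp
... | inj₂ (inj₂ apy)  = apy

-- Complete bipartite graphs K₂,ₘ

insert-self : ∀ {m k} (i : Fin (suc m)) (j : Fin (suc k)) (π : Permutation.Permutation m k) →
  insert i j π ⟨$⟩ʳ i ≡ j
insert-self i j π with i ≟ i
... | yes _   = refl
... | no i≢i = contradiction refl i≢i

module _ {m} {a₁ a₂ : Fin (suc (suc m))} (a₁≢a₂ : a₁ ≢ a₂) where

  pin : Permutation′ (suc (suc m))
  pin = insert a₁ zero (insert (punchOut a₁≢a₂) zero Permutation.id)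

  pin-a₁ : pin ⟨$⟩ʳ a₁ ≡ zero
  pin-a₁ = insert-self a₁ zero _

  pin-a₂ : pin ⟨$⟩ʳ a₂ ≡ suc zero
  pin-a₂ = begin
    pin ⟨$⟩ʳ a₂
      ≡⟨ cong (pin ⟨$⟩ʳ_) (sym (punchIn-punchOut a₁≢a₂)) ⟩
    pin ⟨$⟩ʳ punchIn a₁ (punchOut a₁≢a₂)
      ≡⟨ insert-punchIn a₁ zero _ (punchOut a₁≢a₂) ⟩
    suc (insert (punchOut a₁≢a₂) zero Permutation.id ⟨$⟩ʳ punchOut a₁≢a₂)
      ≡⟨ cong suc (insert-self (punchOut a₁≢a₂) zero Permutation.id) ⟩
    suc zero ∎
    where open ≡-Reasoning

isoK₂ : (a : Adj n) (χ : Fin n → Bool) {a₁ a₂ : Fin n} → a₁ ≢ a₂ →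
  χ a₁ ≡ true → χ a₂ ≡ true → (∀ u → χ u ≡ true → u ≡ a₁ ⊎ u ≡ a₂) →
  (∀ u v → a u v ≡ χ u xor χ v) → IsoK2 a (n ∸ 2)
isoK₂ {zero}       _ _ {()}
isoK₂ {suc zero}   _ _ {zero} {zero} a₁≢a₂ = contradiction refl a₁≢a₂
isoK₂ {suc (suc m)} a χ {a₁} {a₂} a₁≢a₂ χa₁ χa₂ χ⇒pair adj≡xor =
  pin a₁≢a₂ , λ u v → trans (adj≡xor u v) (cong₂ _xor_ (χ≡small u) (χ≡small v))
  where
  injective : ∀ {u v} → pin a₁≢a₂ ⟨$⟩ʳ u ≡ pin a₁≢a₂ ⟨$⟩ʳ v → u ≡ v
  injective = Injection.injective (↔⇒↣ (pin a₁≢a₂))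

  χ≡small : ∀ u → χ u ≡ (toℕ (pin a₁≢a₂ ⟨$⟩ʳ u) <ᵇ 2)
  χ≡small u with pin a₁≢a₂ ⟨$⟩ʳ u in πu
  ... | zero        = trans (cong χ (injective (trans πu (sym (pin-a₁ a₁≢a₂))))) χa₁
  ... | suc zero    = trans (cong χ (injective (trans πu (sym (pin-a₂ a₁≢a₂))))) χa₂
  ... | suc (suc _) = ¬-not (outside ∘ χ⇒pair u)
    where
    outside : u ≡ a₁ ⊎ u ≡ a₂ → ⊥
    outside (inj₁ refl) = contradiction (trans (sym πu) (pin-a₁ a₁≢a₂)) λ ()
    outside (inj₂ refl) = contradiction (trans (sym πu) (pin-a₂ a₁≢a₂)) λ ()

-- Bipartite 2-critical graphs

module TwoCritical (G : Graph n) (side : Fin n → Bool) (connected : Connected (adj G))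
  (bip : IsBipartition (adj G) side) (critical : Critical (adj G) 2) where

  private
    a : Adj n
    a = adj G

  minimal : ∀ {j} → SWin a j → 2 ≤ j
  minimal = proj₂ (proj₁ critical) _

  ¬SWin₁ : ¬ SWin a 1
  ¬SWin₁ win with minimal win
  ... | s≤s ()

  ¬dominating-emptyV : ¬ Dominating a emptyV
  ¬dominating-emptyV D with minimal {0} (done D)
  ... | ()

  ¬SWin₂-deleteEdge : ∀ {u v} → a u v ≡ true → ¬ SWin (deleteEdge a u v) 2
  ¬SWin₂-deleteEdge auv win = <-irrefl refl (proj₂ critical _ _ auv 2 win)

  reply-to : ∀ s → Reply {a = a} s
  reply-to = SWin₂⇒reply ¬dominating-emptyV (proj₁ (proj₁ critical))

  neighbour : ∀ v → Σ _ λ w → a w v ≡ true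
  neighbour v = last-edge (connected (Reply.d (reply-to v)) v) (Reply.d≢s (reply-to v))

  no-dominating-vertex : ∀ c → ¬ Dominates₁ a c
  no-dominating-vertex c Dc with reply-to c
  ... | reply d d≢c finish with any? (λ v → ¬? (v ≟ c) ×-dec ¬? (v ≟ d))
  ...   | yes (s₂ , s₂≢c , s₂≢d) with finish s₂ s₂≢c s₂≢d
  ...     | d₂ , d₂≢c , d₂≢s₂ , D = dominating-pair-splits bip D
    (dominated-same-side bip Dc s₂≢c d≢c) s₂≢d (≢-sym d₂≢s₂) (dominated-same-side bip Dc d₂≢c d≢c)
  no-dominating-vertex c Dc | reply d d≢c _ | no ∄third =
    ¬SWin₁ (two-dominating-vertices⇒SWin₁ (≢-sym d≢c) Dc Dd)
    where
    Dd : Dominates₁ a d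
    Dd v with v ≟ d | v ≟ c
    ... | yes v≡d | _        = inj₁ v≡d
    ... | no _    | yes refl = inj₂ (flip-adj G (dominator-adjacent bip Dc d≢c))
    ... | no v≢d  | no v≢c   = contradiction (v , v≢c , v≢d) ∄third

  part-not-within-singleton : ∀ b c → ¬ (∀ {v} → side v ≡ b → v ≡ c)
  part-not-within-singleton b c within = no-dominating-vertex c covers
    where
    covers : Dominates₁ a c
    covers v with side v ≟ᵇ b | neighbour v
    ... | yes sv≡b | _       = inj₁ (within sv≡b)
    ... | no sv≢b  | w , awv =
      inj₂ (subst (λ x → a x v ≡ true) (within (both-≢⇒≡ (bip w v awv) (≢-sym sv≢b))) awv)

  part-nonempty : ∀ b → ¬ (∀ v → side v ≢ b)
  part-nonempty b empty =
    part-not-within-singleton b (inhabitant ¬dominating-emptyV) λ {v} sv≡b → contradiction sv≡b (empty v)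

  isolated-impossible : ∀ {v c} → side v ≡ c → (W : ExactlyTwo (λ w → side w ≡ not c)) →
    a (ExactlyTwo.x₁ W) v ≡ false → a (ExactlyTwo.x₂ W) v ≡ false → ⊥
  isolated-impossible {v} sv W e₁ e₂ with neighbour v
  ... | w , awv with ExactlyTwo.only W (neighbour-side bip (flip-adj G awv) sv)
  ...   | inj₁ refl = contradiction (trans (sym awv) e₁) λ ()
  ...   | inj₂ refl = contradiction (trans (sym awv) e₂) λ ()

  module Matching (X : ExactlyTwo (λ v → side v ≡ true)) (Y : ExactlyTwo (λ v → side v ≡ false)) where
    open ExactlyTwo X using (x₁; x₂; x₁≢x₂) renaming (P-x₁ to side-x₁; P-x₂ to side-x₂; only to only-x)
    open ExactlyTwo Y using () renaming (x₁ to y₁; x₂ to y₂; x₁≢x₂ to y₁≢y₂;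
                                         P-x₁ to side-y₁; P-x₂ to side-y₂; only to only-y)

    across : ∀ {x y} → side x ≡ true → side y ≡ false → x ≢ y
    across = opposite-sides⇒≢ side

    cover : ∀ v → (v ≡ x₁ ⊎ v ≡ y₁) ⊎ (v ≡ x₂ ⊎ v ≡ y₂)
    cover v with side v in sv
    ... | true  = Sum.[ inj₁ ∘ inj₁ , inj₂ ∘ inj₁ ] (only-x sv)
    ... | false = Sum.[ inj₁ ∘ inj₂ , inj₂ ∘ inj₂ ] (only-y sv)

    matching-wins : ∀ {u v} → deleteEdge a u v x₁ y₁ ≡ true → deleteEdge a u v x₂ y₂ ≡ true →
      SWin (deleteEdge a u v) 2
    matching-wins e₁ e₂ = crossDominating⇒SWin₂ (matching⇒crossDominating (removeEdge G _ _)
      (across side-x₁ side-y₁) (across side-x₂ side-y₂) x₁≢x₂ (across side-x₁ side-y₂)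
      (across side-x₂ side-y₁ ∘ sym) y₁≢y₂ cover e₁ e₂)

    -- A third edge can be deleted keeping the matching x₁y₁, x₂y₂; without one, {x₁, y₁} is a
    -- connected component.
    matching-impossible : a x₁ y₁ ≡ true → a x₂ y₂ ≡ true → ⊥
    matching-impossible e₁₁ e₂₂ with a x₁ y₂ in e₁₂ | a x₂ y₁ in e₂₁
    ... | true | _ = ¬SWin₂-deleteEdge e₁₂ (matching-wins
      (trans (deleteEdge-keeps a (inj₂ y₁≢y₂) (inj₁ (across side-x₁ side-y₂))) e₁₁)
      (trans (deleteEdge-keeps a (inj₁ (x₁≢x₂ ∘ sym)) (inj₁ (across side-x₂ side-y₂))) e₂₂))
    ... | _ | true = ¬SWin₂-deleteEdge e₂₁ (matching-wins
      (trans (deleteEdge-keeps a (inj₁ x₁≢x₂) (inj₁ (across side-x₁ side-y₁))) e₁₁)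
      (trans (deleteEdge-keeps a (inj₂ (y₁≢y₂ ∘ sym)) (inj₁ (across side-x₂ side-y₁))) e₂₂))
    ... | false | false =
      Sum.[ x₁≢x₂ ∘ sym , across side-x₂ side-y₁ ] (reach-closed P closed (connected x₁ x₂) (inj₁ refl))
      where
      P : Fin n → Set
      P v = v ≡ x₁ ⊎ v ≡ y₁
      closed : ∀ {u w} → P u → a u w ≡ true → P w
      closed (inj₁ refl) auw with only-y (neighbour-side bip auw side-x₁)
      ... | inj₁ w≡y₁ = inj₂ w≡y₁
      ... | inj₂ refl = contradiction (trans (sym auw) e₁₂) λ ()
      closed (inj₂ refl) auw with only-x (neighbour-side bip auw side-y₁)
      ... | inj₁ w≡x₁ = inj₁ w≡x₁
      ... | inj₂ refl = contradiction (trans (sym (flip-adj G auw)) e₂₁) λ ()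

  two-two-impossible : ExactlyTwo (λ v → side v ≡ true) → ExactlyTwo (λ v → side v ≡ false) → ⊥
  two-two-impossible X@(exactlyTwo x₁ x₂ _ side-x₁ side-x₂ _) Y@(exactlyTwo y₁ y₂ _ side-y₁ side-y₂ _)
    with a x₁ y₁ in e₁₁ | a x₂ y₂ in e₂₂ | a x₁ y₂ in e₁₂ | a x₂ y₁ in e₂₁
  ... | true  | true  | _     | _     = Matching.matching-impossible X Y e₁₁ e₂₂
  ... | _     | _     | true  | true  = Matching.matching-impossible X (exactlyTwo-swap Y) e₁₂ e₂₁
  ... | false | _     | false | _     = isolated-impossible side-x₁ Y (flip-adj G e₁₁) (flip-adj G e₁₂)
  ... | false | _     | _     | false = isolated-impossible side-y₁ X e₁₁ e₂₁
  ... | _     | false | false | _     = isolated-impossible side-y₂ X e₁₂ e₂₂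
  ... | _     | false | _     | false = isolated-impossible side-x₂ Y (flip-adj G e₂₁) (flip-adj G e₂₂)

  module TwoMany {b} (A : ExactlyTwo (λ v → side v ≡ b)) (B : Three (λ v → side v ≡ not b))
    (size-b : partSize side b ≡ 2) (size-¬b : 3 ≤ partSize side (not b)) where
    open ExactlyTwo A

    sole-neighbour : (C : ExactlyTwo (λ v → side v ≡ b)) → ∀ {y} → side y ≡ not b →
      a (ExactlyTwo.x₂ C) y ≡ false → ∀ {u} → a u y ≡ true → u ≡ ExactlyTwo.x₁ C
    sole-neighbour (exactlyTwo _ _ _ _ _ only-b) sy ¬ac'y auy with only-b (neighbour-side⁻ bip auy sy)
    ... | inj₁ u≡c  = u≡c
    ... | inj₂ refl = contradiction (trans (sym auy) ¬ac'y) λ ()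

    second-adjacent : (C : ExactlyTwo (λ v → side v ≡ b)) → ∀ {y} → side y ≡ not b →
      a (ExactlyTwo.x₂ C) y ≡ true
    second-adjacent C@(exactlyTwo c c' c≢c' sc sc' only-b) {y} sy = ¬-not no-private-neighbour
      where
      no-private-neighbour : a c' y ≢ false
      no-private-neighbour ¬ac'y with reply-to c
      ... | R@(reply d d≢c finish)
        with reply-to-sole-neighbour R (opposite-sides⇒≢ side sc sy ∘ sym) (sole-neighbour C sy ¬ac'y)
      ... | refl with finish c' (c≢c' ∘ sym) (opposite-sides⇒≢ side sc' sy)
      ... | d₂ , d₂≢c , d₂≢c' , D with avoid₂ B d d₂
      ... | w , sw , w≢d , w≢d₂ =
        dominating-pair-splits bip D (trans sw (sym sy)) w≢d w≢d₂ (trans side-d₂ (sym sy))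
        where
        side-d₂ : side d₂ ≡ not b
        side-d₂ = ¬-not (Sum.[ d₂≢c , d₂≢c' ] ∘ only-b)

    adjacent-across : ∀ {u v} → side u ≡ b → side v ≡ not b → a u v ≡ true
    adjacent-across su sv with only su
    ... | inj₁ refl = second-adjacent (exactlyTwo-swap A) sv
    ... | inj₂ refl = second-adjacent A sv

    χ : Fin n → Bool
    χ u = ⌊ side u ≟ᵇ b ⌋

    χ-true : ∀ {u} → side u ≡ b → χ u ≡ true
    χ-true = Equivalence.to T-≡ ∘ fromWitness

    χ⇒part : ∀ u → χ u ≡ true → u ≡ x₁ ⊎ u ≡ x₂
    χ⇒part u = only ∘ toWitness ∘ Equivalence.from T-≡

    adjacency : ∀ u v → a u v ≡ χ u xor χ v
    adjacency u v with side u ≟ᵇ b | side v ≟ᵇ b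
    ... | yes su | yes sv = same-side-nonadjacent bip (trans su (sym sv))
    ... | yes su | no sv  = adjacent-across su (¬-not sv)
    ... | no su  | yes sv = flip-adj G (adjacent-across sv (¬-not su))
    ... | no su  | no sv  = same-side-nonadjacent bip (both-≢⇒≡ su sv)

    5≤n : 5 ≤ n
    5≤n = subst (5 ≤_) (trans (cong (_+ partSize side (not b)) (sym size-b)) (partSize-sum side b))
                (s≤s (s≤s size-¬b))

    K₂,ₘ : Σ ℕ λ m → 3 ≤ m × IsoK2 a m
    K₂,ₘ = n ∸ 2 , ∸-monoˡ-≤ 2 5≤n , isoK₂ a χ x₁≢x₂ (χ-true P-x₁) (χ-true P-x₂) χ⇒part adjacency

  module BipDomPairs (pair : ∀ b → BipDomPair {a = a} {side} b) where

    outsider-edge : ∀ {c u w} → side u ≡ c → side w ≡ not c →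
      BipDomPair.Avoids (pair c) u → BipDomPair.Avoids (pair (not c)) w → a u w ≡ true → ⊥
    outsider-edge {c} su sw u-avoids w-avoids auw = ¬SWin₂-deleteEdge auw (bipDomPairs⇒SWin₂
      (bipDomPair-deleteEdge (pair c) u-avoids
        (BipDomPair.avoids-by-side (pair c) λ sw≡c → not-¬ sw≡c sw))
      (bipDomPair-deleteEdge (pair (not c))
        (BipDomPair.avoids-by-side (pair (not c)) (not-¬ su)) w-avoids))

    exactly-two : ∀ b → Three (λ v → side v ≡ not b) → ExactlyTwoBipDom a side b
    exactly-two b others = u₁ , u₂ , u₁≢u₂ , side-u₁ , side-u₂ , bipDom-u₁ , bipDom-u₂ , only
      where
      open BipDomPair (pair b)
      opposite : BipDomPair (not b)
      opposite = pair (not b)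
      only : ∀ z → side z ≡ b → BipDom a side z → z ≡ u₁ ⊎ z ≡ u₂
      only z sz bz with member-or-avoids z
      ... | inj₁ z∈ = z∈
      ... | inj₂ z-avoids with avoid₂ others (BipDomPair.u₁ opposite) (BipDomPair.u₂ opposite)
      ...   | w , sw , w≢u₁ , w≢u₂ =
        ⊥-elim (outsider-edge sz sw z-avoids (w≢u₁ , w≢u₂) (bz w (≡-not⇒≢ sz sw ∘ sym)))

    degree-two : ∀ v → ¬ BipDom a side v → degree a v ≡ 2
    degree-two v ¬bv = exactlyTwo⇒size≡2 neighbours (adjacencyCensus a v)
      where
      open BipDomPair (pair (not (side v)))
      adjacent : ∀ {u} → u ≡ u₁ ⊎ u ≡ u₂ → a v u ≡ true
      adjacent u∈ = flip-adj G (member-bipDom u∈ v (≡-not⇒≢ refl (member-side u∈)))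
      only : ∀ {w} → a v w ≡ true → w ≡ u₁ ⊎ w ≡ u₂
      only {w} avw with member-or-avoids w
      ... | inj₁ w∈ = w∈
      ... | inj₂ w-avoids = ⊥-elim (outsider-edge refl (neighbour-side bip avw refl)
                              (BipDomPair.avoids-non-bipDom (pair (side v)) ¬bv) w-avoids avw)
      neighbours : ExactlyTwo (λ w → a v w ≡ true)
      neighbours = exactlyTwo u₁ u₂ u₁≢u₂ (adjacent (inj₁ refl)) (adjacent (inj₂ refl)) only

  module ManyMany (T : Three (λ v → side v ≡ true)) (F : Three (λ v → side v ≡ false)) where

    three-on : ∀ b → Three (λ v → side v ≡ b)
    three-on true  = T
    three-on false = F

    threat-across : ∀ {d p} → Dominates₂ a d p → side p ≢ side d
    threat-across {d} {p} D with avoid₂ (three-on (side d)) d p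
    ... | w , sw , w≢d , w≢p = dominating-pair-splits bip D sw w≢d w≢p

    doubleThreat-at : ∀ s → DoubleThreat {a = a} s
    doubleThreat-at s with reply-to s
    ... | R@(reply d _ _) with avoid₂ T s d
    ...   | _ , _ , s₂≢s , s₂≢d = reply⇒doubleThreat no-dominating-vertex R s₂≢s s₂≢d

    reply-bipDom : ∀ {s} (DT : DoubleThreat {a = a} s) → BipDom a side (DoubleThreat.d DT)
    reply-bipDom (doubleThreat _ _ _ _ _ _ _ _ p≢q Dp Dq) =
      threats⇒bipDom bip Dp Dq p≢q (threat-across Dp) (threat-across Dq)

    another-bipDom : ∀ v → Σ _ λ v' → v' ≢ v × side v' ≡ side v × BipDom a side v'
    another-bipDom v with doubleThreat-at v
    ... | DT@(doubleThreat d p _ d≢v p≢v _ _ _ _ Dp _) with side d ≟ᵇ side v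
    ...   | yes sd≡sv = d , d≢v , sd≡sv , reply-bipDom DT
    ...   | no sd≢sv  = p , p≢v , both-≢⇒≡ (threat-across Dp) (sd≢sv ∘ sym) ,
                        partner-bipDom G bip Dp (threat-across Dp) (reply-bipDom DT)

    bipDomPair-on : ∀ b → BipDomPair {a = a} {side} b
    bipDomPair-on b with three-on b
    ... | three x _ _ _ _ _ sx _ _ with another-bipDom x
    ...   | u₁ , _ , su₁ , bu₁ with another-bipDom u₁
    ...     | u₂ , u₂≢u₁ , su₂ , bu₂ =
      bipDomPair u₁ u₂ (u₂≢u₁ ∘ sym) (trans su₁ sx) (trans su₂ (trans su₁ sx)) bu₁ bu₂

    open BipDomPairs bipDomPair-on public using (degree-two)

    exactly-two : ∀ b → ExactlyTwoBipDom a side b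
    exactly-two b = BipDomPairs.exactly-two bipDomPair-on b (three-on (not b))

lemma4p6 : ∀ {n} (G : Graph n) (side : Fin n → Bool) →
    Connected (adj G) → IsBipartition (adj G) side →
    Critical (adj G) 2 →
    (Σ ℕ λ m → 3 ≤ m × IsoK2 (adj G) m)
    ⊎ (3 ≤ partSize side true × 3 ≤ partSize side false ×
       (∀ b → ExactlyTwoBipDom (adj G) side b) ×
       (∀ v → ¬ BipDom (adj G) side v → degree (adj G) v ≡ 2))
lemma4p6 G side connected bip critical = by-part-sizes (partCensus side true) (partCensus side false)
  where
  open TwoCritical G side connected bip critical
  by-part-sizes : Census (λ v → side v ≡ true) (partSize side true) →
                  Census (λ v → side v ≡ false) (partSize side false) →
                  (Σ ℕ λ m → 3 ≤ m × IsoK2 (adj G) m)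
                  ⊎ (3 ≤ partSize side true × 3 ≤ partSize side false ×
                     (∀ b → ExactlyTwoBipDom (adj G) side b) ×
                     (∀ v → ¬ BipDom (adj G) side v → degree (adj G) v ≡ 2))
  by-part-sizes (none empty)     _                = ⊥-elim (part-nonempty true empty)
  by-part-sizes _                (none empty)     = ⊥-elim (part-nonempty false empty)
  by-part-sizes (one {c} _ only) _                = ⊥-elim (part-not-within-singleton true c only)
  by-part-sizes _                (one {c} _ only) = ⊥-elim (part-not-within-singleton false c only)
  by-part-sizes (two X _)        (two Y _)        = ⊥-elim (two-two-impossible X Y)
  by-part-sizes (two X size≡2)   (many F 3≤size)  = inj₁ (TwoMany.K₂,ₘ X F size≡2 3≤size)
  by-part-sizes (many T 3≤size)  (two Y size≡2)   = inj₁ (TwoMany.K₂,ₘ Y T size≡2 3≤size)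
  by-part-sizes (many T 3≤T)     (many F 3≤F)     =
    inj₂ (3≤T , 3≤F , ManyMany.exactly-two T F , ManyMany.degree-two T F)
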